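{- Let $S$ be a string over $\Sigma$ ending with a unique end-marker $\$$ and let $a\in\Sigma$. In $\mathsf{STree}(S)$, let $v$ be the lowest ancestor of the leaf $S$ such that the Weiner link $W_a(v)$ is defined, and let $ax=W_a(v)$ be its destination node. Let $c$ be the first character on the path from (the locus of) $av$ to $ax$. If $av$ is not a node of $\mathsf{STree}(S)$ (i.e., lies in the interior of an edge) and $ax$ is a leaf, then $(d,c)\in\Phi_{aS}(av)\setminus\Phi_S(av)$, where $d\in\Sigma$ is the unique character immediately preceding $ax$ in $S$.
   Context: $\mathrm{occ}_X(w)$ is the number of starting positions $i$ with $X[i..i+|w|-1]=w$; a repeat of $X$ is a $w$ with $\mathrm{occ}_X(w)\ge2$; for a repeat $w$, $\Phi_X(w) = \{(\alpha,\beta)\in\Sigma\times\Sigma \mid \mathrm{occ}_X(\alpha w\beta)=\mathrm{occ}_X(\alpha w)=\mathrm{occ}_X(w\beta)=1\}$, and $\Phi_X(w)=\emptyset$ if $w$ is not a repeat. $\mathsf{STree}(S)$ is the suffix tree of $S$: the compacted trie (edges labeled by non-empty strings, internal nodes branching) representing all suffixes of $S$, whose leaves are exactly the suffixes of $S$ since $S$ ends with unique $\$$; nodes are identified with the strings they spell, and a string that is a prefix of a path label but not a node lies on an edge. For a node $v$ and character $a$, the Weiner link $W_a(v)$ is the node $avy$ with $y$ the shortest string such that $avy$ is a node; it is undefined if $av$ does not occur in $S$. -}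

module Defs where

open import Data.Bool using (Bool; true; false; if_then_else_)
open import Data.Nat using (ℕ; zero; suc; _+_; _≤_; _<_)
open import Data.List using (List; []; _∷_; _++_; [_]; length)
open import Data.List.Membership.Propositional using (_∈_)
open import Data.Product using (Σ; _×_; ∃; ∃-syntax)
open import Data.Sum using (_⊎_)
open import Relation.Nullary using (¬_; does)
open import Relation.Binary.Definitions using (DecidableEquality)
open import Relation.Binary.PropositionalEquality using (_≡_; _≢_)

module _ {A : Set} (_≟_ : DecidableEquality A) where

  startsWith : List A → List A → Bool
  startsWith []      _        = true
  startsWith (_ ∷ _) []       = false
  startsWith (c ∷ w) (x ∷ X)  = if does (c ≟ x) then startsWith w X else false

  occ : List A → List A → ℕ
  occ []      w = if startsWith w [] then 1 else 0
  occ (x ∷ X) w = (if startsWith w (x ∷ X) then 1 else 0) + occ X w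

  EndsWithUnique : A → List A → Set
  EndsWithUnique $ S = ∃[ T ] (S ≡ T ++ [ $ ] × ¬ ($ ∈ T))

  -- (α , β) ∈ Φ_X(w); Φ_X(w) = ∅ when w is not a repeat, hence the first conjunct
  InΦ : List A → List A → A → A → Set
  InΦ X w α β =
    2 ≤ occ X w
    × occ X (α ∷ (w ++ [ β ])) ≡ 1
    × occ X (α ∷ w) ≡ 1
    × occ X (w ++ [ β ]) ≡ 1

  -- Nodes of STree(S), identified with the strings they spell.
  -- Leaves: exactly the (non-empty) suffixes of S.
  IsLeaf : List A → List A → Set
  IsLeaf S w = (w ≢ []) × ∃[ u ] (S ≡ u ++ w)

  IsInternal : List A → List A → Set
  IsInternal S w =
    (w ≡ [])
    ⊎ (∃[ b ] ∃[ b′ ] (b ≢ b′ × 1 ≤ occ S (w ++ [ b ]) × 1 ≤ occ S (w ++ [ b′ ])))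

  IsNode : List A → List A → Set
  IsNode S w = IsLeaf S w ⊎ IsInternal S w

  IsAncestor : List A → List A → List A → Set
  IsAncestor S v u = IsNode S v × ∃[ z ] (u ≡ v ++ z)

  WeinerLink : List A → A → List A → List A → Set
  WeinerLink S a v w =
    ∃[ y ] (w ≡ a ∷ (v ++ y)
           × IsNode S w
           × (∀ y′ → IsNode S (a ∷ (v ++ y′)) → length y ≤ length y′))

  WeinerDefined : List A → A → List A → Set
  WeinerDefined S a v = ∃[ w ] WeinerLink S a v w

  LowestWeinerAncestor : List A → A → List A → Set
  LowestWeinerAncestor S a v =
    IsAncestor S v S
    × WeinerDefined S a v
    × (∀ v′ → IsAncestor S v′ S → length v < length v′ → ¬ WeinerDefined S a v′)

-- Write S = U a v y, where a x = a v y is the target of the Weiner link and y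
-- is the shortest extension of a v to a node. A second occurrence of a v would
-- branch from the one at U strictly inside y (the unique end-marker prevents
-- one continuation from being a prefix of the other), giving a node shorter
-- than a v y; so a v occurs only at U. Likewise v c is not a prefix of S:
-- otherwise v c would branch from its occurrence inside a x at a node v c z on
-- the path to the leaf S, strictly below v, whose Weiner link is still a x,
-- contradicting the choice of v. Prepending a creates exactly one new
-- occurrence of a v, at the front, neither preceded by d nor followed by c;
-- so a v becomes a repeat while d a v, a v c and d a v c still occur once.
module Submission where

open import Defs
open import Data.Bool using (true; false)
open import Data.Empty using (⊥-elim)
open import Data.List using (List; []; _∷_; _++_; [_]; _∷ʳ_; length; initLast; _∷ʳ′_)
open import Data.List.Properties
  using (≡-dec; ∷-injectiveˡ; ∷-injectiveʳ; ∷ʳ-injectiveʳ; ∷ʳ-++; ++-assoc; ++-identityʳ;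
         ++-cancelˡ; ++-cancelʳ; ++-conicalˡ; ++-conicalʳ; length-++)
open import Data.List.Membership.Propositional using (_∈_)
open import Data.List.Relation.Unary.Any using (here; there)
open import Data.Nat using (suc; _+_; _≤_; _<_; z≤n; s≤s)
open import Data.Nat.Properties
  using (≤-refl; ≤-reflexive; ≤-trans; ≤-antisym; m≤n+m; m<m+n; m+1+n≰m; +-cancelˡ-≤; module ≤-Reasoning)
open import Data.Product using (_×_; _,_; ∃-syntax)
open import Data.Sum using (_⊎_; inj₁; inj₂)
open import Function using (_∘_)
open import Relation.Nullary using (¬_; yes; no)
open import Relation.Nullary.Decidable using (dec-true)
open import Relation.Binary.Definitions using (DecidableEquality)
open import Relation.Binary.PropositionalEquality
  using (_≡_; _≢_; refl; sym; trans; cong; cong₂; subst; module ≡-Reasoning)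

module _ {A : Set} (_≟_ : DecidableEquality A) where

  record OccursAt (X w u : List A) : Set where
    constructor occurs
    field
      rest   : List A
      splits : X ≡ u ++ w ++ rest

  AtMostOnce : List A → List A → Set
  AtMostOnce X w = ∀ {u u′} → OccursAt X w u → OccursAt X w u′ → u ≡ u′

  ProperPrefix : List A → List A → Set
  ProperPrefix z P = ∃[ b ] ∃[ P′ ] (P ≡ z ++ b ∷ P′)

  Diverge : List A → List A → Set
  Diverge P Q = ∃[ z ] ∃[ b ] ∃[ b′ ] ∃[ P′ ] ∃[ Q′ ]
    (b ≢ b′ × P ≡ z ++ b ∷ P′ × Q ≡ z ++ b′ ∷ Q′)

  NoShorterNodeExtension : List A → List A → List A → Set
  NoShorterNodeExtension S w y = ∀ y′ → IsNode _≟_ S (w ++ y′) → length y ≤ length y′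

  occursAt-∷ : ∀ x {X w u} → OccursAt X w u → OccursAt (x ∷ X) w (x ∷ u)
  occursAt-∷ x (occurs r e) = occurs r (cong (x ∷_) e)

  occursAt-++ʳ : ∀ {X} w s {u} → OccursAt X (w ++ s) u → OccursAt X w u
  occursAt-++ʳ w s {u} (occurs r e) = occurs (s ++ r) (trans e (cong (u ++_) (++-assoc w s r)))

  occursAt-++ˡ : ∀ {X} p w {u} → OccursAt X (p ++ w) u → OccursAt X w (u ++ p)
  occursAt-++ˡ p w {u} (occurs r e) = occurs r (begin
    _                    ≡⟨ e ⟩
    u ++ (p ++ w) ++ r   ≡⟨ cong (u ++_) (++-assoc p w r) ⟩
    u ++ p ++ w ++ r     ≡⟨ ++-assoc u p (w ++ r) ⟨
    (u ++ p) ++ w ++ r   ∎)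
    where open ≡-Reasoning

  occursAt-extend : ∀ {X} w s {u r} → X ≡ u ++ w ++ s ++ r → OccursAt X (w ++ s) u
  occursAt-extend w s {u} {r} e = occurs r (trans e (cong (u ++_) (sym (++-assoc w s r))))

  startsWith-++ : ∀ w r → startsWith _≟_ w (w ++ r) ≡ true
  startsWith-++ []      r = refl
  startsWith-++ (c ∷ w) r rewrite dec-true (c ≟ c) refl = startsWith-++ w r

  startsWith-sound : ∀ w X → startsWith _≟_ w X ≡ true → OccursAt X w []
  startsWith-sound []      X       _ = occurs X refl
  startsWith-sound (c ∷ w) (x ∷ X) e with c ≟ x
  ... | yes refl with startsWith-sound w X e
  ...   | occurs r X≡w++r = occurs r (cong (c ∷_) X≡w++r)

  occursAt-[]⇒startsWith : ∀ {X w} → OccursAt X w [] → startsWith _≟_ w X ≡ true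
  occursAt-[]⇒startsWith {w = w} (occurs r refl) = startsWith-++ w r

  occ-≥1 : ∀ {X w} u → OccursAt X w u → 1 ≤ occ _≟_ X w
  occ-≥1 {[]}    [] o rewrite occursAt-[]⇒startsWith o = s≤s z≤n
  occ-≥1 {_ ∷ _} [] o rewrite occursAt-[]⇒startsWith o = s≤s z≤n
  occ-≥1 (t ∷ u) (occurs r refl) = ≤-trans (occ-≥1 u (occurs r refl)) (m≤n+m _ _)

  occ-≥2 : ∀ {x X w} u → OccursAt (x ∷ X) w [] → OccursAt X w u → 2 ≤ occ _≟_ (x ∷ X) w
  occ-≥2 u atHead later rewrite occursAt-[]⇒startsWith atHead = s≤s (occ-≥1 u later)

  occ-≡0 : ∀ X w → (∀ {u} → ¬ OccursAt X w u) → occ _≟_ X w ≡ 0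
  occ-≡0 [] w none with startsWith _≟_ w [] in e
  ... | true  = ⊥-elim (none (startsWith-sound w [] e))
  ... | false = refl
  occ-≡0 (x ∷ X) w none with startsWith _≟_ w (x ∷ X) in e
  ... | true  = ⊥-elim (none (startsWith-sound w (x ∷ X) e))
  ... | false = occ-≡0 X w (λ o → none (occursAt-∷ x o))

  occ-≤1 : ∀ X w → AtMostOnce X w → occ _≟_ X w ≤ 1
  occ-≤1 [] w _ with startsWith _≟_ w []
  ... | true  = ≤-refl
  ... | false = z≤n
  occ-≤1 (x ∷ X) w once with startsWith _≟_ w (x ∷ X) in e
  ... | true  = ≤-reflexive (cong suc (occ-≡0 X w notLater))
    where
    notLater : ∀ {u} → ¬ OccursAt X w u
    notLater o with once (startsWith-sound w (x ∷ X) e) (occursAt-∷ x o)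
    ... | ()
  ... | false = occ-≤1 X w (λ o o′ → ∷-injectiveʳ (once (occursAt-∷ x o) (occursAt-∷ x o′)))

  occ-≡1 : ∀ {X w} u → OccursAt X w u → AtMostOnce X w → occ _≟_ X w ≡ 1
  occ-≡1 {X} {w} u o once = ≤-antisym (occ-≤1 X w once) (occ-≥1 u o)

  atMostOnce-++ʳ : ∀ {X} w s → AtMostOnce X w → AtMostOnce X (w ++ s)
  atMostOnce-++ʳ w s once o o′ = once (occursAt-++ʳ w s o) (occursAt-++ʳ w s o′)

  atMostOnce-++ˡ : ∀ {X} p w → AtMostOnce X w → AtMostOnce X (p ++ w)
  atMostOnce-++ˡ p w once o o′ = ++-cancelʳ p _ _ (once (occursAt-++ˡ p w o) (occursAt-++ˡ p w o′))

  atMostOnce-∷ : ∀ x {X w} → AtMostOnce X w → ¬ OccursAt (x ∷ X) w [] → AtMostOnce (x ∷ X) w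
  atMostOnce-∷ x once notHead {[]}    o _  = ⊥-elim (notHead o)
  atMostOnce-∷ x once notHead {_ ∷ _} {[]} _ o′ = ⊥-elim (notHead o′)
  atMostOnce-∷ x once notHead {_ ∷ _} {_ ∷ _} (occurs r e) (occurs r′ e′) =
    cong₂ _∷_ (trans (sym (∷-injectiveˡ e)) (∷-injectiveˡ e′))
              (once (occurs r (∷-injectiveʳ e)) (occurs r′ (∷-injectiveʳ e′)))

  ¬inΦ : ∀ {X w α β} → AtMostOnce X w → ¬ InΦ _≟_ X w α β
  ¬inΦ {X} {w} once (repeat , _) with ≤-trans repeat (occ-≤1 X w once)
  ... | s≤s ()

  inΦ-∷ : ∀ {a c d S u v y} → AtMostOnce S (a ∷ v) → ¬ (∃[ r ] (S ≡ v ++ c ∷ r))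
    → ∃[ z ] (S ≡ v ++ z) → S ≡ u ++ d ∷ a ∷ v ++ c ∷ y → InΦ _≟_ (a ∷ S) (a ∷ v) d c
  inΦ-∷ {a} {c} {d} {S} {u} {v} {y} once ¬vc-prefix (z , S≡v++z) eu =
      occ-≥2 (u ++ [ d ]) (occurs z (cong (a ∷_) S≡v++z)) (occursAt-++ˡ [ d ] (a ∷ v) dav)
    , occ-≡1 (a ∷ u) (occursAt-∷ a davc) (atMostOnce-++ʳ (d ∷ a ∷ v) [ c ] onceDav)
    , occ-≡1 (a ∷ u) (occursAt-∷ a dav) onceDav
    , occ-≡1 (a ∷ u ++ [ d ]) (occursAt-∷ a (occursAt-++ˡ [ d ] (a ∷ v ++ [ c ]) davc)) onceAvc
    where
    dav : OccursAt S (d ∷ a ∷ v) u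
    dav = occurs (c ∷ y) eu

    davc : OccursAt S (d ∷ a ∷ v ++ [ c ]) u
    davc = occursAt-extend (d ∷ a ∷ v) [ c ] eu

    onceDav : AtMostOnce (a ∷ S) (d ∷ a ∷ v)
    onceDav = atMostOnce-∷ a (atMostOnce-++ˡ [ d ] (a ∷ v) once) notHead
      where
      notHead : ¬ OccursAt (a ∷ S) (d ∷ a ∷ v) []
      notHead (occurs r e)
        with ++-conicalʳ u [ d ] (sym (once (occurs r (∷-injectiveʳ e)) (occursAt-++ˡ [ d ] (a ∷ v) dav)))
      ... | ()

    onceAvc : AtMostOnce (a ∷ S) (a ∷ v ++ [ c ])
    onceAvc = atMostOnce-∷ a (atMostOnce-++ʳ (a ∷ v) [ c ] once)
      (λ (occurs r e) → ¬vc-prefix (r , trans (∷-injectiveʳ e) (∷ʳ-++ v c r)))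

  prefix-or-diverge : ∀ P Q → ∃[ s ] (Q ≡ P ++ s) ⊎ ∃[ s ] (P ≡ Q ++ s) ⊎ Diverge P Q
  prefix-or-diverge []      Q       = inj₁ (Q , refl)
  prefix-or-diverge (p ∷ P) []      = inj₂ (inj₁ (p ∷ P , refl))
  prefix-or-diverge (p ∷ P) (q ∷ Q) with p ≟ q
  ... | no p≢q = inj₂ (inj₂ ([] , p , q , P , Q , p≢q , refl , refl))
  ... | yes refl with prefix-or-diverge P Q
  ...   | inj₁ (s , e)        = inj₁ (s , cong (p ∷_) e)
  ...   | inj₂ (inj₁ (s , e)) = inj₂ (inj₁ (s , cong (p ∷_) e))
  ...   | inj₂ (inj₂ (z , b , b′ , P′ , Q′ , b≢b′ , eP , eQ)) =
    inj₂ (inj₂ (p ∷ z , b , b′ , P′ , Q′ , b≢b′ , cong (p ∷_) eP , cong (p ∷_) eQ))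

  ∷ʳ-≢[] : ∀ (w : List A) x → w ∷ʳ x ≢ []
  ∷ʳ-≢[] []      _ ()
  ∷ʳ-≢[] (_ ∷ _) _ ()

  unsnoc-≢[] : ∀ {w : List A} → w ≢ [] → ∃[ w₀ ] ∃[ c ] (w ≡ w₀ ∷ʳ c)
  unsnoc-≢[] {w} w≢[] with initLast w
  ... | []       = ⊥-elim (w≢[] refl)
  ... | w₀ ∷ʳ′ c = w₀ , c , refl

  endMarker-notFollowed : ∀ {$ : A} (T : List A) → ¬ $ ∈ T → ∀ u {x r} → T ++ [ $ ] ≢ u ++ $ ∷ x ∷ r
  endMarker-notFollowed []      _    []          ()
  endMarker-notFollowed []      _    (_ ∷ [])    ()
  endMarker-notFollowed []      _    (_ ∷ _ ∷ _) ()
  endMarker-notFollowed (_ ∷ T) $∉T []      e = $∉T (here (sym (∷-injectiveˡ e)))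
  endMarker-notFollowed (_ ∷ T) $∉T (_ ∷ u) e = endMarker-notFollowed T ($∉T ∘ there) u (∷-injectiveʳ e)

  suffix-occursOnlyAtEnd : ∀ {$ S w u u′ s} → EndsWithUnique _≟_ $ S
    → w ≢ [] → S ≡ u ++ w → S ≡ u′ ++ w ++ s → u ≡ u′
  suffix-occursOnlyAtEnd {w = w} {u} {u′} {[]} _ _ e e′ =
    ++-cancelʳ w u u′ (trans (sym e) (trans e′ (cong (u′ ++_) (++-identityʳ w))))
  suffix-occursOnlyAtEnd {$} {S} {w} {u} {u′} {x ∷ s} (T , S≡T$ , $∉T) w≢[] e e′
    with unsnoc-≢[] w≢[]
  ... | w₀ , c , refl = ⊥-elim (endMarker-notFollowed T $∉T (u′ ++ w₀) $-followed-by-x∷s)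
    where
    c≡$ : c ≡ $
    c≡$ = sym (∷ʳ-injectiveʳ T (u ++ w₀) (trans (sym S≡T$) (trans e (sym (++-assoc u w₀ [ c ])))))
    $-followed-by-x∷s : T ++ [ $ ] ≡ (u′ ++ w₀) ++ $ ∷ x ∷ s
    $-followed-by-x∷s = begin
      T ++ [ $ ]                ≡⟨ S≡T$ ⟨
      S                         ≡⟨ e′ ⟩
      u′ ++ (w₀ ∷ʳ c) ++ x ∷ s  ≡⟨ cong (u′ ++_) (∷ʳ-++ w₀ c (x ∷ s)) ⟩
      u′ ++ w₀ ++ c ∷ x ∷ s     ≡⟨ ++-assoc u′ w₀ (c ∷ x ∷ s) ⟨
      (u′ ++ w₀) ++ c ∷ x ∷ s   ≡⟨ cong (λ t → (u′ ++ w₀) ++ t ∷ x ∷ s) c≡$ ⟩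
      (u′ ++ w₀) ++ $ ∷ x ∷ s   ∎
      where open ≡-Reasoning

  isInternal-branching : ∀ {S w u u′ b b′} → b ≢ b′
    → OccursAt S (w ∷ʳ b) u → OccursAt S (w ∷ʳ b′) u′ → IsInternal _≟_ S w
  isInternal-branching {u = u} {u′} {b} {b′} b≢b′ o o′ =
    inj₂ (b , b′ , b≢b′ , occ-≥1 u o , occ-≥1 u′ o′)

  branchingNode : ∀ {$ S w u u′ P Q} → EndsWithUnique _≟_ $ S → w ≢ []
    → S ≡ u ++ w ++ P → S ≡ u′ ++ w ++ Q → u ≢ u′
    → ∃[ z ] (IsInternal _≟_ S (w ++ z) × ProperPrefix z P × ProperPrefix z Q)
  branchingNode {S = S} {w} {u} {u′} {P} {Q} unique$ w≢[] e e′ u≢u′ with prefix-or-diverge P Q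
  ... | inj₁ (s , refl) = ⊥-elim (u≢u′ (suffix-occursOnlyAtEnd unique$ (w≢[] ∘ ++-conicalˡ w P) e
          (trans e′ (cong (u′ ++_) (sym (++-assoc w P s))))))
  ... | inj₂ (inj₁ (s , refl)) = ⊥-elim (u≢u′ (sym (suffix-occursOnlyAtEnd unique$
          (w≢[] ∘ ++-conicalˡ w Q) e′ (trans e (cong (u ++_) (sym (++-assoc w Q s)))))))
  ... | inj₂ (inj₂ (z , b , b′ , P′ , Q′ , b≢b′ , refl , refl)) =
    z , isInternal-branching b≢b′ (branchAt u e) (branchAt u′ e′) , (b , P′ , refl) , (b′ , Q′ , refl)
    where
    branchAt : ∀ x {b R} → S ≡ x ++ w ++ z ++ b ∷ R → OccursAt S ((w ++ z) ∷ʳ b) x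
    branchAt x {b} {R} eq = occurs R (trans eq (cong (x ++_) (begin
      w ++ z ++ b ∷ R      ≡⟨ ++-assoc w z (b ∷ R) ⟨
      (w ++ z) ++ b ∷ R    ≡⟨ ∷ʳ-++ (w ++ z) b R ⟨
      (w ++ z) ∷ʳ b ++ R   ∎)))
      where open ≡-Reasoning

  noShorterNodeExtension⇒atMostOnce : ∀ {$ S w U y} → EndsWithUnique _≟_ $ S → w ≢ []
    → S ≡ U ++ w ++ y → NoShorterNodeExtension S w y → AtMostOnce S w
  noShorterNodeExtension⇒atMostOnce {S = S} {w} {U} {y} unique$ w≢[] eU noShorter o o′ =
    trans (onlyAtU o) (sym (onlyAtU o′))
    where
    onlyAtU : ∀ {u} → OccursAt S w u → u ≡ U
    onlyAtU {u} (occurs r e) with ≡-dec _≟_ u U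
    ... | yes u≡U = u≡U
    ... | no u≢U with branchingNode unique$ w≢[] e eU u≢U
    ...   | z , internal , _ , b , y′ , y≡z++b∷y′ =
      ⊥-elim (m+1+n≰m (length z) (begin
        length z + suc (length y′)  ≡⟨ length-++ z ⟨
        length (z ++ b ∷ y′)        ≡⟨ cong length y≡z++b∷y′ ⟨
        length y                    ≤⟨ noShorter z (inj₂ internal) ⟩
        length z                    ∎))
      where open ≤-Reasoning

  noShorterNodeExtension-++ : ∀ {S w} p {y} → NoShorterNodeExtension S w (p ++ y)
    → NoShorterNodeExtension S (w ++ p) y
  noShorterNodeExtension-++ {S} {w} p {y} noShorter y′ node = +-cancelˡ-≤ (length p) _ _ (begin
    length p + length y   ≡⟨ length-++ p ⟨
    length (p ++ y)       ≤⟨ noShorter (p ++ y′) (subst (IsNode _≟_ S) (++-assoc w p y′) node) ⟩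
    length (p ++ y′)      ≡⟨ length-++ p ⟩
    length p + length y′  ∎)
    where open ≤-Reasoning

  lowestWeinerAncestor⇒¬prefix : ∀ {$ S a v c y U} → EndsWithUnique _≟_ $ S
    → (∀ v′ → IsAncestor _≟_ S v′ S → length v < length v′ → ¬ WeinerDefined _≟_ S a v′)
    → IsNode _≟_ S (a ∷ v ++ c ∷ y) → NoShorterNodeExtension S (a ∷ v) (c ∷ y)
    → S ≡ U ++ a ∷ v ++ c ∷ y → ¬ (∃[ r ] (S ≡ v ++ c ∷ r))
  lowestWeinerAncestor⇒¬prefix {S = S} {a} {v} {c} {y} {U} unique$ lowest node noShorter eU (r , e)
    with branchingNode {u = []} {U ∷ʳ a} unique$ (∷ʳ-≢[] v c)
           (trans e (sym (∷ʳ-++ v c r))) vc-after-a (∷ʳ-≢[] U a ∘ sym)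
    where
    vc-after-a : S ≡ (U ∷ʳ a) ++ (v ∷ʳ c) ++ y
    vc-after-a = trans eU (sym (trans (∷ʳ-++ U a _) (cong (λ t → U ++ a ∷ t) (∷ʳ-++ v c y))))
  ... | z , internal , (b , r′ , r≡z++b∷r′) , (b′ , y′ , y≡z++b′∷y′) =
    lowest (v ++ c ∷ z) ancestor longer weinerDefined
    where
    ancestor : IsAncestor _≟_ S (v ++ c ∷ z) S
    ancestor = inj₂ (subst (IsInternal _≟_ S) (∷ʳ-++ v c z) internal)
             , b ∷ r′
             , trans e (trans (cong (λ t → v ++ c ∷ t) r≡z++b∷r′) (sym (++-assoc v (c ∷ z) (b ∷ r′))))

    longer : length v < length (v ++ c ∷ z)
    longer = subst (length v <_) (sym (length-++ v)) (m<m+n (length v) (s≤s z≤n))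

    weinerDefined : WeinerDefined _≟_ S a (v ++ c ∷ z)
    weinerDefined = a ∷ v ++ c ∷ y , b′ ∷ y′
      , cong (a ∷_) (trans (cong (λ t → v ++ c ∷ t) y≡z++b′∷y′) (sym (++-assoc v (c ∷ z) (b′ ∷ y′))))
      , node
      , noShorterNodeExtension-++ (c ∷ z)
          (subst (NoShorterNodeExtension S (a ∷ v)) (cong (c ∷_) y≡z++b′∷y′) noShorter)

lemma9 : {A : Set} (_≟_ : DecidableEquality A) ($ a : A) (S : List A)
    → EndsWithUnique _≟_ $ S
    → (v x : List A)
    → LowestWeinerAncestor _≟_ S a v
    → WeinerLink _≟_ S a v (a ∷ x)
    → (c : A) → (∃[ y ] (a ∷ x ≡ (a ∷ v) ++ (c ∷ y)))
    → (d : A) → (∃[ u ] (S ≡ u ++ (d ∷ (a ∷ x))))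
    → ¬ IsNode _≟_ S (a ∷ v)
    → IsLeaf _≟_ S (a ∷ x)
    → InΦ _≟_ (a ∷ S) (a ∷ v) d c × ¬ InΦ _≟_ S (a ∷ v) d c
lemma9 _≟_ $ a S unique$ v x ((_ , v-prefix) , _ , lowest) (y , refl , node , noShorter) c (y′ , ec) d (u , eu) _ _
  with ++-cancelˡ v y (c ∷ y′) (∷-injectiveʳ ec)
... | refl = inΦ-∷ _≟_ once ¬vc-prefix v-prefix eu , ¬inΦ _≟_ once
  where
  av-after-d : S ≡ (u ∷ʳ d) ++ a ∷ v ++ c ∷ y′
  av-after-d = trans eu (sym (∷ʳ-++ u d _))

  once : AtMostOnce _≟_ S (a ∷ v)
  once = noShorterNodeExtension⇒atMostOnce _≟_ unique$ (λ ()) av-after-d noShorter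

  ¬vc-prefix : ¬ (∃[ r ] (S ≡ v ++ c ∷ r))
  ¬vc-prefix = lowestWeinerAncestor⇒¬prefix _≟_ unique$ lowest node noShorter av-after-d
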